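{- For every positive integer $d$ there exists a binary matrix $M$ such that $R_{bool}(M)=4d$ and $R_{\mathbb{R}}(M)=3d$.
   Context: A binary matrix has entries in $\{0,1\}$. $R_{\mathbb{R}}(M)$ is the usual rank over the reals. The boolean rank $R_{bool}(M)$ of an $n\times m$ binary matrix $M$ is the minimal $k$ such that $M=U\cdot V$ with $U$ an $n\times k$ and $V$ a $k\times m$ binary matrix, where the matrix product uses boolean arithmetic ($0+x=x$, $1+1=1$, $1\cdot1=1$, $x\cdot 0=0$); equivalently, the minimal number of all-ones combinatorial rectangles (submatrices) covering the $1$-entries of $M$.
   Formalization: The real rank $R_{\mathbb{R}}(M)$ is taken over ℚ: the factors U and V in its factorisations $M=U\cdot V$ have rational rather than real entries. -}

module Defs where

open import Data.Nat using (ℕ; zero; suc; _≤_)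
open import Data.Fin using (Fin; zero; suc)
open import Data.Bool using (Bool; true; false; _∧_; _∨_)
open import Data.Rational using (ℚ; 0ℚ; 1ℚ; _+_; _*_)
open import Data.Product using (Σ; _×_)
open import Relation.Binary.PropositionalEquality using (_≡_)

Matrix : Set → ℕ → ℕ → Set
Matrix A n m = Fin n → Fin m → A

bigOr : ∀ {k} → (Fin k → Bool) → Bool
bigOr {zero}  f = false
bigOr {suc k} f = f zero ∨ bigOr (λ i → f (suc i))

bigSum : ∀ {k} → (Fin k → ℚ) → ℚ
bigSum {zero}  f = 0ℚ
bigSum {suc k} f = f zero + bigSum (λ i → f (suc i))

_⊙_ : ∀ {n k m} → Matrix Bool n k → Matrix Bool k m → Matrix Bool n m
(U ⊙ V) i j = bigOr (λ l → U i l ∧ V l j)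

_⊛_ : ∀ {n k m} → Matrix ℚ n k → Matrix ℚ k m → Matrix ℚ n m
(U ⊛ V) i j = bigSum (λ l → U i l * V l j)

b2q : Bool → ℚ
b2q false = 0ℚ
b2q true  = 1ℚ

toℚ : ∀ {n m} → Matrix Bool n m → Matrix ℚ n m
toℚ M i j = b2q (M i j)

BoolFactors : ∀ {n m} → Matrix Bool n m → ℕ → Set
BoolFactors {n} {m} M k =
  Σ (Matrix Bool n k) λ U → Σ (Matrix Bool k m) λ V → ∀ i j → (U ⊙ V) i j ≡ M i j

ℚFactors : ∀ {n m} → Matrix ℚ n m → ℕ → Set
ℚFactors {n} {m} M k =
  Σ (Matrix ℚ n k) λ U → Σ (Matrix ℚ k m) λ V → ∀ i j → (U ⊛ V) i j ≡ M i j

BoolRankIs : ∀ {n m} → Matrix Bool n m → ℕ → Set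
BoolRankIs M r = BoolFactors M r × (∀ k → BoolFactors M k → r ≤ k)

ℚRankIs : ∀ {n m} → Matrix ℚ n m → ℕ → Set
ℚRankIs M r = ℚFactors M r × (∀ k → ℚFactors M k → r ≤ k)

-- R_ℝ(M) = r for a binary matrix M (real rank = rational rank for rational entries).
RealRankIs : ∀ {n m} → Matrix Bool n m → ℕ → Set
RealRankIs M r = ℚRankIs (toℚ M) r

-- Take M = C₄ ⊗ I_d, where C₄ is the 4 × 4 circulant with ones on the
-- diagonal and the cyclic superdiagonal.
--
-- Boolean rank: M i j = M j i = 1 only for i = j, so the diagonal is a fooling
-- set: a rectangle containing two diagonal ones would contain a symmetric pair
-- of ones off the diagonal. Every cover thus needs 4d rectangles, and 4d is
-- reached by the trivial factorisation M = I ⊙ M.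
--
-- Real rank: the last row of C₄ is the alternating sum of the other three, so
-- rank C₄ ≤ 3 and, by the mixed-product rule for Kronecker products,
-- rank M ≤ 3d. Conversely the minor of C₄ on rows 0,1,2 and columns 1,2,3 is
-- lower unitriangular, hence so is its Kronecker product with I_d, a 3d × 3d
-- minor of M; Gaussian elimination shows that a lower unitriangular r × r
-- matrix has no factorisation through fewer than r dimensions.
module Submission where

open import Defs
open import Data.Nat using (ℕ; _*_; _≤_)
open import Data.Product using (Σ; _×_)
open import Data.Bool using (Bool)

open import Algebra.Bundles using (CommutativeRing)
open import Data.Bool using (true; false; _∧_; _∨_)
open import Data.Bool.Properties using (∨-identityʳ)
import Data.Bool.Properties as Boolₚ
open import Data.Fin using (Fin; zero; suc; toℕ; _<_; combine; remQuot; quotient; remainder; punchIn; inject₁; _↑ˡ_; _↑ʳ_)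
open import Data.Fin.Properties using (_≟_; _<?_; all?; <-cmp; <-asym; <⇒≢; ¬∀⟶∃¬; injective⇒≤; combine-remQuot; remQuot-combine; toℕ-combine; combine-monoˡ-<)
open import Data.Nat using (zero; suc; z≤n; s≤s; z<s)
import Data.Nat as ℕ
import Data.Nat.Properties as ℕ
open import Data.Product using (_,_; proj₁; proj₂; ∃; map; uncurry′)
open import Data.Rational using (ℚ; 0ℚ; 1ℚ; 1/_; ≢-nonZero)
import Data.Rational as ℚ
import Data.Rational.Properties as ℚₚ
open import Data.Sum using (_⊎_; inj₁; inj₂)
import Data.Sum as Sum
open import Data.Vec using (Vec; []; _∷_; lookup)
open import Function using (id; _∘_)
open import Relation.Binary.Definitions using (tri<; tri≈; tri>)
open import Relation.Binary.PropositionalEquality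
open import Relation.Nullary using (yes; no; contradiction)
open import Relation.Nullary.Decidable using (does; dec-true; dec-false; from-yes; _→-dec_)

open import Algebra.Properties.Semiring.Sum (CommutativeRing.semiring ℚₚ.+-*-commutativeRing) using (sum; sum-syntax; sum-cong-≗; sum-replicate-zero; sum-remove; ∑-distrib-+; *-distribˡ-sum; *-distribʳ-sum)
open import Algebra.Properties.CommutativeSemigroup (CommutativeRing.*-commutativeSemigroup ℚₚ.+-*-commutativeRing) using (interchange)

open ≡-Reasoning

fromRows : ∀ {A : Set} {n m} → Vec (Vec A m) n → Matrix A n m
fromRows rows i j = lookup (lookup rows i) j

I : ∀ {n} → Matrix Bool n n
I i j = does (i ≟ j)

I≡true⇒≡ : ∀ {n} (i j : Fin n) → I i j ≡ true → i ≡ j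
I≡true⇒≡ i j Iij≡true with i ≟ j
... | yes i≡j = i≡j
I≡true⇒≡ i j () | no _

∧≡true⇒ : ∀ {x y} → x ∧ y ≡ true → x ≡ true × y ≡ true
∧≡true⇒ {true} y≡true = refl , y≡true

b2q-∧ : ∀ x y → b2q (x ∧ y) ≡ b2q x ℚ.* b2q y
b2q-∧ false y = sym (ℚₚ.*-zeroˡ (b2q y))
b2q-∧ true  y = sym (ℚₚ.*-identityˡ (b2q y))

-- Boolean rank and fooling sets

bigOr-const-false : ∀ {k} → bigOr {k} (λ _ → false) ≡ false
bigOr-const-false {zero}  = refl
bigOr-const-false {suc k} = bigOr-const-false {k}

bigOr≡true⇒∃ : ∀ {k} (f : Fin k → Bool) → bigOr f ≡ true → ∃ λ l → f l ≡ true
bigOr≡true⇒∃ {suc k} f bigOr≡true with f zero in f₀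
... | true  = zero , f₀
... | false = map suc id (bigOr≡true⇒∃ (f ∘ suc) bigOr≡true)

∃⇒bigOr≡true : ∀ {k} (f : Fin k → Bool) (l : Fin k) → f l ≡ true → bigOr f ≡ true
∃⇒bigOr≡true f zero    fl≡true rewrite fl≡true = refl
∃⇒bigOr≡true f (suc l) fl≡true with f zero
... | true  = refl
... | false = ∃⇒bigOr≡true (f ∘ suc) l fl≡true

⊙-identityˡ : ∀ {n m} (M : Matrix Bool n m) i j → (I ⊙ M) i j ≡ M i j
⊙-identityˡ {suc n} M zero    j = trans (cong (M zero j ∨_) (bigOr-const-false {n})) (∨-identityʳ (M zero j))
⊙-identityˡ         M (suc i) j = ⊙-identityˡ (M ∘ suc) i j

BoolFactors-rows : ∀ {n m} (M : Matrix Bool n m) → BoolFactors M n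
BoolFactors-rows M = I , M , ⊙-identityˡ M

record FoolingSet {n m} (M : Matrix Bool n m) (r : ℕ) : Set where
  field
    row       : Fin r → Fin n
    col       : Fin r → Fin m
    hit       : ∀ i → M (row i) (col i) ≡ true
    separated : ∀ i j → M (row i) (col j) ≡ true → M (row j) (col i) ≡ true → i ≡ j

-- Assign to each fooling entry a rectangle of the cover containing it; if the
-- entries i and j shared a rectangle, M (row i) (col j) and M (row j) (col i)
-- would both be true, so the assignment is injective.
foolingSet⇒boolRank≥ : ∀ {n m r k} {M : Matrix Bool n m} → FoolingSet M r → BoolFactors M k → r ≤ k
foolingSet⇒boolRank≥ {M = M} F (U , V , U⊙V≡M) = injective⇒≤ rectangle-injective
  where
  open FoolingSet F
  rectangleAt : ∀ i → ∃ λ l → U (row i) l ∧ V l (col i) ≡ true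
  rectangleAt i = bigOr≡true⇒∃ _ (trans (U⊙V≡M (row i) (col i)) (hit i))
  rectangle = λ i → proj₁ (rectangleAt i)
  row∈rectangle : ∀ i → U (row i) (rectangle i) ≡ true
  row∈rectangle i = proj₁ (∧≡true⇒ (proj₂ (rectangleAt i)))
  col∈rectangle : ∀ j → V (rectangle j) (col j) ≡ true
  col∈rectangle j = proj₂ (∧≡true⇒ (proj₂ (rectangleAt j)))
  sharedRectangle : ∀ {i j} → rectangle i ≡ rectangle j → M (row i) (col j) ≡ true
  sharedRectangle {i} {j} same = trans (sym (U⊙V≡M (row i) (col j)))
    (∃⇒bigOr≡true _ (rectangle i)
      (cong₂ _∧_ (row∈rectangle i) (subst (λ l → V l (col j) ≡ true) (sym same) (col∈rectangle j))))
  rectangle-injective : ∀ {i j} → rectangle i ≡ rectangle j → i ≡ j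
  rectangle-injective same = separated _ _ (sharedRectangle same) (sharedRectangle (sym same))

I-foolingSet : ∀ {n} → FoolingSet (I {n}) n
I-foolingSet = record
  { row       = id
  ; col       = id
  ; hit       = λ i → dec-true (i ≟ i) refl
  ; separated = λ i j Iij≡true _ → I≡true⇒≡ i j Iij≡true
  }

-- Rational rank and unitriangular matrices

bigSum≡sum : ∀ {k} (f : Fin k → ℚ) → bigSum f ≡ sum f
bigSum≡sum {zero}  f = refl
bigSum≡sum {suc k} f = cong (f zero ℚ.+_) (bigSum≡sum (f ∘ suc))

⊛≡sum : ∀ {n k m} (U : Matrix ℚ n k) (V : Matrix ℚ k m) i j → (U ⊛ V) i j ≡ ∑[ l < k ] (U i l ℚ.* V l j)
⊛≡sum U V i j = bigSum≡sum (λ l → U i l ℚ.* V l j)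

sum≢0⇒∃≢0 : ∀ {k} (f : Fin k → ℚ) → sum f ≢ 0ℚ → ∃ λ l → f l ≢ 0ℚ
sum≢0⇒∃≢0 {k} f sum≢0 = ¬∀⟶∃¬ k (λ l → f l ≡ 0ℚ) (λ l → f l ℚₚ.≟ 0ℚ)
  (λ f≡0 → sum≢0 (trans (sum-cong-≗ f≡0) (sum-replicate-zero k)))

≡0⊎≡0⇒*≡0 : ∀ {x y} → x ≡ 0ℚ ⊎ y ≡ 0ℚ → x ℚ.* y ≡ 0ℚ
≡0⊎≡0⇒*≡0 {y = y} (inj₁ x≡0) = trans (cong (ℚ._* y) x≡0) (ℚₚ.*-zeroˡ y)
≡0⊎≡0⇒*≡0 {x = x} (inj₂ y≡0) = trans (cong (x ℚ.*_) y≡0) (ℚₚ.*-zeroʳ x)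

⊛-identityˡ : ∀ {n m} (M : Matrix ℚ n m) i j → (toℚ I ⊛ M) i j ≡ M i j
⊛-identityˡ {suc n} M zero j = begin
  1ℚ ℚ.* M zero j ℚ.+ bigSum (λ l → 0ℚ ℚ.* M (suc l) j)  ≡⟨ cong₂ ℚ._+_ (ℚₚ.*-identityˡ (M zero j)) zeros ⟩
  M zero j ℚ.+ 0ℚ                                       ≡⟨ ℚₚ.+-identityʳ (M zero j) ⟩
  M zero j                                              ∎
  where
  zeros : bigSum (λ l → 0ℚ ℚ.* M (suc l) j) ≡ 0ℚ
  zeros = trans (bigSum≡sum (λ l → 0ℚ ℚ.* M (suc l) j))
                (trans (sum-cong-≗ (λ l → ℚₚ.*-zeroˡ (M (suc l) j))) (sum-replicate-zero n))
⊛-identityˡ M (suc i) j =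
  trans (cong (ℚ._+ (toℚ I ⊛ (M ∘ suc)) i j) (ℚₚ.*-zeroˡ (M zero j)))
        (trans (ℚₚ.+-identityˡ ((toℚ I ⊛ (M ∘ suc)) i j)) (⊛-identityˡ (M ∘ suc) i j))

ℚFactors-rows : ∀ {n m} (M : Matrix ℚ n m) → ℚFactors M n
ℚFactors-rows M = toℚ I , M , ⊛-identityˡ M

ℚFactors-cong : ∀ {n m k} {M N : Matrix ℚ n m} → (∀ i j → M i j ≡ N i j) → ℚFactors M k → ℚFactors N k
ℚFactors-cong M≡N (U , V , UV≡M) = U , V , λ i j → trans (UV≡M i j) (M≡N i j)

ℚFactors-minor : ∀ {n m r s k} {M : Matrix ℚ n m} (row : Fin r → Fin n) (col : Fin s → Fin m) →
  ℚFactors M k → ℚFactors (λ i j → M (row i) (col j)) k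
ℚFactors-minor row col (U , V , UV≡M) = U ∘ row , (λ l j → V l (col j)) , λ i j → UV≡M (row i) (col j)

-- Add c i times row 0 of U to row i + 1, with c i chosen to clear the pivot
-- column p; column p of U and row p of V then contribute nothing and are dropped.
eliminatePivot : ∀ {r k m} (U : Matrix ℚ (suc r) (suc k)) (V : Matrix ℚ (suc k) m) (p : Fin (suc k)) →
  U zero p ≢ 0ℚ →
  ∃ λ (c : Fin r → ℚ) → ℚFactors (λ i j → (U ⊛ V) (suc i) j ℚ.+ c i ℚ.* (U ⊛ V) zero j) k
eliminatePivot {r} {k} U V p U₀p≢0 = c , (λ i l → W i (punchIn p l)) , (λ l j → V (punchIn p l) j) , reduced
  where
  instance
    _ = ≢-nonZero U₀p≢0
  c : Fin r → ℚ
  c i = ℚ.- U (suc i) p ℚ.* 1/ U zero p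
  W : Fin r → Fin (suc k) → ℚ
  W i l = U (suc i) l ℚ.+ c i ℚ.* U zero l
  W-pivot : ∀ i → W i p ≡ 0ℚ
  W-pivot i = begin
    U (suc i) p ℚ.+ (ℚ.- U (suc i) p ℚ.* 1/ U zero p) ℚ.* U zero p
      ≡⟨ cong (U (suc i) p ℚ.+_) (ℚₚ.*-assoc (ℚ.- U (suc i) p) (1/ U zero p) (U zero p)) ⟩
    U (suc i) p ℚ.+ ℚ.- U (suc i) p ℚ.* (1/ U zero p ℚ.* U zero p)
      ≡⟨ cong (λ t → U (suc i) p ℚ.+ ℚ.- U (suc i) p ℚ.* t) (ℚₚ.*-inverseˡ (U zero p)) ⟩
    U (suc i) p ℚ.+ ℚ.- U (suc i) p ℚ.* 1ℚ
      ≡⟨ cong (U (suc i) p ℚ.+_) (ℚₚ.*-identityʳ (ℚ.- U (suc i) p)) ⟩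
    U (suc i) p ℚ.+ ℚ.- U (suc i) p
      ≡⟨ ℚₚ.+-inverseʳ (U (suc i) p) ⟩
    0ℚ
      ∎
  reduced : ∀ i j → bigSum (λ l → W i (punchIn p l) ℚ.* V (punchIn p l) j) ≡
                    (U ⊛ V) (suc i) j ℚ.+ c i ℚ.* (U ⊛ V) zero j
  reduced i j = begin
    bigSum (λ l → t (punchIn p l))       ≡⟨ bigSum≡sum (λ l → t (punchIn p l)) ⟩
    sum (λ l → t (punchIn p l))          ≡⟨ ℚₚ.+-identityˡ _ ⟨
    0ℚ ℚ.+ sum (λ l → t (punchIn p l))   ≡⟨ cong (ℚ._+ sum (λ l → t (punchIn p l))) t-pivot ⟨
    t p ℚ.+ sum (λ l → t (punchIn p l))  ≡⟨ sum-remove {i = p} t ⟨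
    sum t                                ≡⟨ sum-cong-≗ row-operation ⟩
    ∑[ l < suc k ] (U (suc i) l ℚ.* V l j ℚ.+ c i ℚ.* (U zero l ℚ.* V l j))
      ≡⟨ ∑-distrib-+ (λ l → U (suc i) l ℚ.* V l j) (λ l → c i ℚ.* (U zero l ℚ.* V l j)) ⟩
    ∑[ l < suc k ] (U (suc i) l ℚ.* V l j) ℚ.+ ∑[ l < suc k ] (c i ℚ.* (U zero l ℚ.* V l j))
      ≡⟨ cong (∑[ l < suc k ] (U (suc i) l ℚ.* V l j) ℚ.+_) (*-distribˡ-sum (c i) (λ l → U zero l ℚ.* V l j)) ⟨
    ∑[ l < suc k ] (U (suc i) l ℚ.* V l j) ℚ.+ c i ℚ.* ∑[ l < suc k ] (U zero l ℚ.* V l j)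
      ≡⟨ cong₂ (λ s s′ → s ℚ.+ c i ℚ.* s′) (⊛≡sum U V (suc i) j) (⊛≡sum U V zero j) ⟨
    (U ⊛ V) (suc i) j ℚ.+ c i ℚ.* (U ⊛ V) zero j
      ∎
    where
    t : Fin (suc k) → ℚ
    t l = W i l ℚ.* V l j
    t-pivot : t p ≡ 0ℚ
    t-pivot = ≡0⊎≡0⇒*≡0 (inj₁ (W-pivot i))
    row-operation : ∀ l → t l ≡ U (suc i) l ℚ.* V l j ℚ.+ c i ℚ.* (U zero l ℚ.* V l j)
    row-operation l = trans (ℚₚ.*-distribʳ-+ (V l j) (U (suc i) l) (c i ℚ.* U zero l))
                            (cong (U (suc i) l ℚ.* V l j ℚ.+_) (ℚₚ.*-assoc (c i) (U zero l) (V l j)))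

record LowerUnitriangular {r} (T : Matrix ℚ r r) : Set where
  field
    diagonal       : ∀ i → T i i ≡ 1ℚ
    above-diagonal : ∀ i j → i < j → T i j ≡ 0ℚ

lowerUnitriangular-tail : ∀ {r} {T : Matrix ℚ (suc r) (suc r)} →
  LowerUnitriangular T → LowerUnitriangular (λ i j → T (suc i) (suc j))
lowerUnitriangular-tail L = record
  { diagonal       = λ i → diagonal (suc i)
  ; above-diagonal = λ i j i<j → above-diagonal (suc i) (suc j) (s≤s i<j)
  }
  where open LowerUnitriangular L

-- Row 0 of T is (1, 0, …, 0): it provides a pivot, and eliminating it leaves
-- the remaining rows of T unchanged outside column 0.
lowerUnitriangular-tail-ℚFactors : ∀ {r k} {T : Matrix ℚ (suc r) (suc r)} →
  LowerUnitriangular T → ℚFactors T (suc k) → ℚFactors (λ i j → T (suc i) (suc j)) k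
lowerUnitriangular-tail-ℚFactors {r} {k} {T} L (U , V , UV≡T) = restrict (eliminatePivot U V p U₀p≢0)
  where
  open LowerUnitriangular L
  pivot : ∃ λ p → U zero p ℚ.* V p zero ≢ 0ℚ
  pivot = sum≢0⇒∃≢0 (λ l → U zero l ℚ.* V l zero) λ sum≡0 →
    ℚₚ.1≢0 (trans (sym (diagonal zero)) (trans (sym (UV≡T zero zero)) (trans (⊛≡sum U V zero zero) sum≡0)))
  p = proj₁ pivot
  U₀p≢0 : U zero p ≢ 0ℚ
  U₀p≢0 U₀p≡0 = proj₂ pivot (≡0⊎≡0⇒*≡0 (inj₁ U₀p≡0))
  restrict : (∃ λ (c : Fin r → ℚ) → ℚFactors (λ i j → (U ⊛ V) (suc i) j ℚ.+ c i ℚ.* (U ⊛ V) zero j) k) →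
    ℚFactors (λ i j → T (suc i) (suc j)) k
  restrict (c , reduced) = ℚFactors-cong unchanged (ℚFactors-minor id suc reduced)
    where
    unchanged : ∀ i j → (U ⊛ V) (suc i) (suc j) ℚ.+ c i ℚ.* (U ⊛ V) zero (suc j) ≡ T (suc i) (suc j)
    unchanged i j = begin
      (U ⊛ V) (suc i) (suc j) ℚ.+ c i ℚ.* (U ⊛ V) zero (suc j)
        ≡⟨ cong₂ (λ s s′ → s ℚ.+ c i ℚ.* s′) (UV≡T (suc i) (suc j)) (UV≡T zero (suc j)) ⟩
      T (suc i) (suc j) ℚ.+ c i ℚ.* T zero (suc j)
        ≡⟨ cong (T (suc i) (suc j) ℚ.+_) (≡0⊎≡0⇒*≡0 {x = c i} (inj₂ (above-diagonal zero (suc j) z<s))) ⟩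
      T (suc i) (suc j) ℚ.+ 0ℚ
        ≡⟨ ℚₚ.+-identityʳ (T (suc i) (suc j)) ⟩
      T (suc i) (suc j)
        ∎

lowerUnitriangular⇒rank≥ : ∀ {r k} {T : Matrix ℚ r r} → LowerUnitriangular T → ℚFactors T k → r ≤ k
lowerUnitriangular⇒rank≥ {zero}          _ _ = z≤n
lowerUnitriangular⇒rank≥ {suc r} {zero}  L (U , V , UV≡T) =
  contradiction (trans (sym (LowerUnitriangular.diagonal L zero)) (sym (UV≡T zero zero))) ℚₚ.1≢0
lowerUnitriangular⇒rank≥ {suc r} {suc k} L F =
  s≤s (lowerUnitriangular⇒rank≥ (lowerUnitriangular-tail L) (lowerUnitriangular-tail-ℚFactors L F))

I-lowerUnitriangular : ∀ {n} → LowerUnitriangular (toℚ (I {n}))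
I-lowerUnitriangular = record
  { diagonal       = λ i → cong b2q (dec-true (i ≟ i) refl)
  ; above-diagonal = λ i j i<j → cong b2q (dec-false (i ≟ j) (<⇒≢ i<j))
  }

-- Kronecker products

-- Opaque, so that unification treats Kronecker products as rigid; their entries
-- are read off through kronecker-entry.
opaque
  kronecker : ∀ {A B C : Set} {r r′ s s′} → (A → B → C) →
    Matrix A r r′ → Matrix B s s′ → Matrix C (r * s) (r′ * s′)
  kronecker {r = r} {r′} {s} {s′} _∙_ X Y i j =
    X (quotient {r} s i) (quotient {r′} s′ j) ∙ Y (remainder {r} s i) (remainder {r′} s′ j)

opaque
  unfolding kronecker

  kronecker-entry : ∀ {A B C : Set} {r r′ s s′} {_∙_ : A → B → C} {X : Matrix A r r′} {Y : Matrix B s s′}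
    {i j a b x y} → remQuot {r} s i ≡ (a , x) → remQuot {r′} s′ j ≡ (b , y) →
    kronecker _∙_ X Y i j ≡ (X a b ∙ Y x y)
  kronecker-entry refl refl = refl

kronecker-combine : ∀ {A B C : Set} {r r′ s s′} {_∙_ : A → B → C} {X : Matrix A r r′} {Y : Matrix B s s′}
  {a b x y} → kronecker _∙_ X Y (combine a x) (combine b y) ≡ (X a b ∙ Y x y)
kronecker-combine = kronecker-entry (remQuot-combine _ _) (remQuot-combine _ _)

_⊗ᵇ_ : ∀ {r r′ s s′} → Matrix Bool r r′ → Matrix Bool s s′ → Matrix Bool (r * s) (r′ * s′)
_⊗ᵇ_ = kronecker _∧_

_⊗_ : ∀ {r r′ s s′} → Matrix ℚ r r′ → Matrix ℚ s s′ → Matrix ℚ (r * s) (r′ * s′)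
_⊗_ = kronecker ℚ._*_

_⊗ᶠ_ : ∀ {r s n m} → (Fin r → Fin n) → (Fin s → Fin m) → Fin (r * s) → Fin (n * m)
_⊗ᶠ_ {r} {s} f g i = combine (f (quotient {r} s i)) (g (remainder {r} s i))

remQuot-injective : ∀ {r s} {i j : Fin (r * s)} → remQuot {r} s i ≡ remQuot s j → i ≡ j
remQuot-injective {r} {s} {i} {j} same = begin
  i                                         ≡⟨ combine-remQuot {r} s i ⟨
  uncurry′ (combine {r} {s}) (remQuot s i)  ≡⟨ cong (uncurry′ (combine {r} {s})) same ⟩
  uncurry′ (combine {r} {s}) (remQuot s j)  ≡⟨ combine-remQuot {r} s j ⟩
  j                                         ∎

toℕ-remQuot : ∀ {r} s (i : Fin (r * s)) → toℕ i ≡ s ℕ.* toℕ (quotient {r} s i) ℕ.+ toℕ (remainder {r} s i)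
toℕ-remQuot {r} s i =
  trans (cong toℕ (sym (combine-remQuot {r} s i))) (toℕ-combine (quotient {r} s i) (remainder {r} s i))

remQuot-<-lex : ∀ {r s} {i j : Fin (r * s)} → i < j →
  quotient {r} s i < quotient {r} s j ⊎
  (quotient {r} s i ≡ quotient {r} s j × remainder {r} s i < remainder {r} s j)
remQuot-<-lex {r} {s} {i} {j} i<j with <-cmp (quotient {r} s i) (quotient {r} s j)
... | tri< qi<qj _ _ = inj₁ qi<qj
... | tri≈ _ qi≡qj _ = inj₂ (qi≡qj , ℕ.+-cancelˡ-< (s ℕ.* toℕ (quotient {r} s j)) _ _
        (subst₂ ℕ._<_ (trans (toℕ-remQuot s i) (cong (λ q → s ℕ.* toℕ q ℕ.+ _) qi≡qj)) (toℕ-remQuot s j) i<j))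
... | tri> _ _ qj<qi = contradiction i<j (<-asym
        (subst₂ _<_ (combine-remQuot {r} s j) (combine-remQuot {r} s i) (combine-monoˡ-< _ _ qj<qi)))

foolingSet-⊗ᵇ : ∀ {n n′ m m′ r s} {X : Matrix Bool n m} {Y : Matrix Bool n′ m′} →
  FoolingSet X r → FoolingSet Y s → FoolingSet (X ⊗ᵇ Y) (r * s)
foolingSet-⊗ᵇ {r = r} {s} {X} {Y} FX FY = record
  { row       = FX.row ⊗ᶠ FY.row
  ; col       = FX.col ⊗ᶠ FY.col
  ; hit       = λ i → trans kronecker-combine (cong₂ _∧_ (FX.hit _) (FY.hit _))
  ; separated = λ i j ij ji → remQuot-injective {r} {s}
      (cong₂ _,_ (FX.separated _ _ (proj₁ (split ij)) (proj₁ (split ji)))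
                 (FY.separated _ _ (proj₂ (split ij)) (proj₂ (split ji))))
  }
  where
  module FX = FoolingSet FX
  module FY = FoolingSet FY
  split : ∀ {i j} → (X ⊗ᵇ Y) ((FX.row ⊗ᶠ FY.row) i) ((FX.col ⊗ᶠ FY.col) j) ≡ true →
    X (FX.row (quotient {r} s i)) (FX.col (quotient {r} s j)) ≡ true ×
    Y (FY.row (remainder {r} s i)) (FY.col (remainder {r} s j)) ≡ true
  split entry≡true = ∧≡true⇒ (trans (sym kronecker-combine) entry≡true)

⊗-lowerUnitriangular : ∀ {r s} {A : Matrix ℚ r r} {B : Matrix ℚ s s} →
  LowerUnitriangular A → LowerUnitriangular B → LowerUnitriangular (A ⊗ B)
⊗-lowerUnitriangular {r} {s} {A} {B} LA LB = record
  { diagonal       = λ i → trans (kronecker-entry refl refl) (cong₂ ℚ._*_ (LA.diagonal _) (LB.diagonal _))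
  ; above-diagonal = above-diagonal
  }
  where
  module LA = LowerUnitriangular LA
  module LB = LowerUnitriangular LB
  above-diagonal : ∀ i j → i < j → (A ⊗ B) i j ≡ 0ℚ
  above-diagonal i j i<j = trans (kronecker-entry refl refl) (≡0⊎≡0⇒*≡0
    (Sum.map (LA.above-diagonal _ _) (LB.above-diagonal _ _ ∘ proj₂) (remQuot-<-lex {r} {s} i<j)))

⊗-cong : ∀ {n n′ m m′} {A A′ : Matrix ℚ n m} {B B′ : Matrix ℚ n′ m′} →
  (∀ i j → A i j ≡ A′ i j) → (∀ i j → B i j ≡ B′ i j) → ∀ i j → (A ⊗ B) i j ≡ (A′ ⊗ B′) i j
⊗-cong A≡A′ B≡B′ i j =
  trans (kronecker-entry refl refl) (trans (cong₂ ℚ._*_ (A≡A′ _ _) (B≡B′ _ _)) (sym (kronecker-entry refl refl)))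

sum-splitAt : ∀ {p q} (f : Fin (p ℕ.+ q) → ℚ) →
  sum f ≡ sum (λ u → f (u ↑ˡ q)) ℚ.+ sum (λ v → f (p ↑ʳ v))
sum-splitAt {zero}      f = sym (ℚₚ.+-identityˡ (sum f))
sum-splitAt {suc p} {q} f = trans (cong (f zero ℚ.+_) (sum-splitAt {p} (f ∘ suc)))
  (sym (ℚₚ.+-assoc (f zero) (sum (λ u → f (suc (u ↑ˡ q)))) (sum (λ v → f (suc (p ↑ʳ v))))))

sum-combine : ∀ {p q} (f : Fin (p * q) → ℚ) → sum f ≡ ∑[ u < p ] ∑[ v < q ] f (combine u v)
sum-combine {zero}      f = refl
sum-combine {suc p} {q} f = trans (sum-splitAt {q} {p * q} f)
  (cong (sum (λ v → f (v ↑ˡ (p * q))) ℚ.+_) (sum-combine {p} (λ v → f (q ↑ʳ v))))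

⊗-mixedProduct : ∀ {n n′ k k′ m m′} (U : Matrix ℚ n k) (U′ : Matrix ℚ n′ k′)
  (V : Matrix ℚ k m) (V′ : Matrix ℚ k′ m′) → ∀ i j →
  ((U ⊗ U′) ⊛ (V ⊗ V′)) i j ≡ ((U ⊛ V) ⊗ (U′ ⊛ V′)) i j
⊗-mixedProduct {n} {n′} {k} {k′} {m} {m′} U U′ V V′ i j = begin
  ((U ⊗ U′) ⊛ (V ⊗ V′)) i j
    ≡⟨ ⊛≡sum (U ⊗ U′) (V ⊗ V′) i j ⟩
  ∑[ l < k * k′ ] ((U ⊗ U′) i l ℚ.* (V ⊗ V′) l j)
    ≡⟨ sum-combine {k} {k′} (λ l → (U ⊗ U′) i l ℚ.* (V ⊗ V′) l j) ⟩
  ∑[ c < k ] ∑[ z < k′ ] ((U ⊗ U′) i (combine c z) ℚ.* (V ⊗ V′) (combine c z) j)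
    ≡⟨ sum-cong-≗ (λ c → sum-cong-≗ (entries c)) ⟩
  ∑[ c < k ] ∑[ z < k′ ] ((U a c ℚ.* U′ x z) ℚ.* (V c b ℚ.* V′ z y))
    ≡⟨ sum-cong-≗ (λ c → sum-cong-≗ (λ z → interchange (U a c) (U′ x z) (V c b) (V′ z y))) ⟩
  ∑[ c < k ] ∑[ z < k′ ] ((U a c ℚ.* V c b) ℚ.* (U′ x z ℚ.* V′ z y))
    ≡⟨ sum-cong-≗ (λ c → *-distribˡ-sum (U a c ℚ.* V c b) (λ z → U′ x z ℚ.* V′ z y)) ⟨
  ∑[ c < k ] ((U a c ℚ.* V c b) ℚ.* ∑[ z < k′ ] (U′ x z ℚ.* V′ z y))
    ≡⟨ *-distribʳ-sum (∑[ z < k′ ] (U′ x z ℚ.* V′ z y)) (λ c → U a c ℚ.* V c b) ⟨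
  ∑[ c < k ] (U a c ℚ.* V c b) ℚ.* ∑[ z < k′ ] (U′ x z ℚ.* V′ z y)
    ≡⟨ cong₂ ℚ._*_ (⊛≡sum U V a b) (⊛≡sum U′ V′ x y) ⟨
  (U ⊛ V) a b ℚ.* (U′ ⊛ V′) x y
    ≡⟨ kronecker-entry refl refl ⟨
  ((U ⊛ V) ⊗ (U′ ⊛ V′)) i j
    ∎
  where
  a = quotient {n} n′ i
  x = remainder {n} n′ i
  b = quotient {m} m′ j
  y = remainder {m} m′ j
  entries : ∀ c z → (U ⊗ U′) i (combine c z) ℚ.* (V ⊗ V′) (combine c z) j ≡
                    (U a c ℚ.* U′ x z) ℚ.* (V c b ℚ.* V′ z y)
  entries c z = cong₂ ℚ._*_ (kronecker-entry refl (remQuot-combine c z)) (kronecker-entry (remQuot-combine c z) refl)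

ℚFactors-⊗ : ∀ {n n′ m m′ k k′} {A : Matrix ℚ n m} {B : Matrix ℚ n′ m′} →
  ℚFactors A k → ℚFactors B k′ → ℚFactors (A ⊗ B) (k * k′)
ℚFactors-⊗ (U , V , UV≡A) (U′ , V′ , U′V′≡B) =
  U ⊗ U′ , V ⊗ V′ , λ i j → trans (⊗-mixedProduct U U′ V V′ i j) (⊗-cong UV≡A U′V′≡B i j)

toℚ-⊗ᵇ : ∀ {n n′ m m′} (X : Matrix Bool n m) (Y : Matrix Bool n′ m′) i j →
  toℚ (X ⊗ᵇ Y) i j ≡ (toℚ X ⊗ toℚ Y) i j
toℚ-⊗ᵇ {n} {n′} {m} {m′} X Y i j = begin
  toℚ (X ⊗ᵇ Y) i j             ≡⟨ cong b2q (kronecker-entry refl refl) ⟩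
  b2q (X a b ∧ Y x y)          ≡⟨ b2q-∧ (X a b) (Y x y) ⟩
  b2q (X a b) ℚ.* b2q (Y x y)  ≡⟨ kronecker-entry refl refl ⟨
  (toℚ X ⊗ toℚ Y) i j          ∎
  where
  a = quotient {n} n′ i
  x = remainder {n} n′ i
  b = quotient {m} m′ j
  y = remainder {m} m′ j

-- The matrix C₄ ⊗ I

C₄ : Matrix Bool 4 4
C₄ = fromRows
  ( (true  ∷ true  ∷ false ∷ false ∷ [])
  ∷ (false ∷ true  ∷ true  ∷ false ∷ [])
  ∷ (false ∷ false ∷ true  ∷ true  ∷ [])
  ∷ (true  ∷ false ∷ false ∷ true  ∷ [])
  ∷ [])

C₄-foolingSet : FoolingSet C₄ 4
C₄-foolingSet = record
  { row       = id
  ; col       = id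
  ; hit       = from-yes (all? λ i → C₄ i i Boolₚ.≟ true)
  ; separated = from-yes (all? λ i → all? λ j →
                  (C₄ i j Boolₚ.≟ true) →-dec (C₄ j i Boolₚ.≟ true) →-dec (i ≟ j))
  }

C₄-ℚFactors : ℚFactors (toℚ C₄) 3
C₄-ℚFactors = U , V , from-yes (all? λ i → all? λ j → (U ⊛ V) i j ℚₚ.≟ toℚ C₄ i j)
  where
  U : Matrix ℚ 4 3
  U = fromRows
    ( (1ℚ ∷ 0ℚ     ∷ 0ℚ ∷ [])
    ∷ (0ℚ ∷ 1ℚ     ∷ 0ℚ ∷ [])
    ∷ (0ℚ ∷ 0ℚ     ∷ 1ℚ ∷ [])
    ∷ (1ℚ ∷ ℚ.- 1ℚ ∷ 1ℚ ∷ [])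
    ∷ [])
  V : Matrix ℚ 3 4
  V l j = toℚ C₄ (inject₁ l) j

C₄-minor-lowerUnitriangular : LowerUnitriangular (λ i j → toℚ C₄ (inject₁ i) (suc j))
C₄-minor-lowerUnitriangular = record
  { diagonal       = from-yes (all? λ i → toℚ C₄ (inject₁ i) (suc i) ℚₚ.≟ 1ℚ)
  ; above-diagonal = from-yes (all? λ i → all? λ j → (i <? j) →-dec (toℚ C₄ (inject₁ i) (suc j) ℚₚ.≟ 0ℚ))
  }

boolRank-C₄⊗I : ∀ d → BoolRankIs (C₄ ⊗ᵇ I {d}) (4 * d)
boolRank-C₄⊗I d =
  BoolFactors-rows (C₄ ⊗ᵇ I) , λ k → foolingSet⇒boolRank≥ (foolingSet-⊗ᵇ C₄-foolingSet I-foolingSet)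

realRank-C₄⊗I : ∀ d → RealRankIs (C₄ ⊗ᵇ I {d}) (3 * d)
realRank-C₄⊗I d =
  ℚFactors-cong (λ i j → sym (toℚ-⊗ᵇ C₄ I i j)) (ℚFactors-⊗ C₄-ℚFactors (ℚFactors-rows (toℚ I))) ,
  λ k factors → lowerUnitriangular⇒rank≥
    (⊗-lowerUnitriangular C₄-minor-lowerUnitriangular (I-lowerUnitriangular {d}))
    (ℚFactors-cong minor-entry (ℚFactors-minor rows cols (ℚFactors-cong (toℚ-⊗ᵇ C₄ I) factors)))
  where
  rows : Fin (3 * d) → Fin (4 * d)
  rows = _⊗ᶠ_ {3} {d} inject₁ id
  cols : Fin (3 * d) → Fin (4 * d)
  cols = _⊗ᶠ_ {3} {d} suc id
  minor-entry : ∀ i j → (toℚ C₄ ⊗ toℚ (I {d})) (rows i) (cols j) ≡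
                        ((λ a b → toℚ C₄ (inject₁ a) (suc b)) ⊗ toℚ (I {d})) i j
  minor-entry i j = trans (kronecker-combine {a = inject₁ (quotient {3} d i)} {b = suc (quotient {3} d j)})
                          (sym (kronecker-entry refl refl))

theorem4 : (d : ℕ) → 1 ≤ d →
    Σ ℕ λ n → Σ ℕ λ m → Σ (Matrix Bool n m) λ M →
      BoolRankIs M (4 * d) × RealRankIs M (3 * d)
theorem4 d _ = 4 * d , 4 * d , C₄ ⊗ᵇ I {d} , boolRank-C₄⊗I d , realRank-C₄⊗I d
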